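{- Let $P$ be a $(k+1)$-ary predicate symbol of Heyting Arithmetic, $t_1,\dots,t_k$ arithmetic terms, and $\mathrm{EM}(P,t_1,\dots,t_k)\equiv(\forall y\,P(t_1,\dots,t_k,y))\vee(\exists y\,\neg P(t_1,\dots,t_k,y))$. Define $\mathrm{em}(P,t_1,\dots,t_k)\equiv\lambda s{:}\mathrm{State}.\,\mathrm{inl}\big(\mathrm{case}\,(\mathrm{query}_P\,s\,t_1\cdots t_k)\,(\lambda\_{:}\mathrm{Unit}.\,\mathrm{inl}(\lambda y{:}\mathrm{Nat}.\lambda\_{:}\mathrm{State}.\,\mathrm{eval}_P\,t_1\cdots t_k\,y))\,(\lambda y{:}\mathrm{Nat}.\,\mathrm{inr}(\mathrm{pair}\,y\,\mathrm{unit}_{\mathrm{Unit}}))\big)$. Then for any formulas $A_1,\dots,A_l$ and proof variables $\alpha_i:|A_i|$, the decorated sequent $\alpha_1:A_1,\dots,\alpha_l:A_l\Vdash\mathrm{em}(P,t_1,\dots,t_k):\mathrm{EM}(P,t_1,\dots,t_k)$ is valid with respect to the interactive realizability semantics, i.e. it is valid with respect to $\Vdash_T^s$ for every closed $s:\mathrm{State}$.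
   Context: System $T'$: types generated from atomic types including $\mathrm{Unit}$, $\mathrm{Nat}$, $\mathrm{State}$, $\mathrm{Ex}$ by $\to,\times,+$; terms of the simply typed $\lambda$-calculus over constants including $\mathrm{unit}:\mathrm{Unit}$, $\mathrm{pair}$, $\pi_1,\pi_2$, $\mathrm{inl},\mathrm{inr}$, $\mathrm{case}:X+Y\to(X\to Z)\to(Y\to Z)\to Z$, $0$, $S$, bounded course-of-value recursors, $\mathrm{merge}_{\mathrm{Ex}}:\mathrm{Ex}\to\mathrm{Ex}\to\mathrm{Ex}$, and for each $(k+1)$-ary predicate symbol $P$: $\mathrm{query}_P:\mathrm{State}\to\mathrm{Nat}^k\to\mathrm{Unit}+\mathrm{Nat}$ and $\mathrm{eval}_P:\mathrm{Nat}^k\to\mathrm{Nat}\to\mathrm{Unit}+\mathrm{Ex}$ (curried); usual $\beta$, projection and case reductions; $\leadsto$ is multistep reduction; $\bar n$ is the numeral of $n$; closed arithmetic terms reduce to numerals of their values. A relation "$e$ properly extends $s$" between closed $e:\mathrm{Ex}$ and $s:\mathrm{State}$ is given (intended: the partial state-extension function denoted by $e$ is defined at $s$ and strictly extends it), satisfying (EX): if $e_1,e_2$ properly extend $s$ then $\mathrm{merge}_{\mathrm{Ex}}e_1e_2$ properly extends $s$. Assumptions, for all closed $s:\mathrm{State}$ and $n_1,\dots,n_k,n\in\mathbb{N}$: (IR1) if $\mathrm{query}_P\,s\,\bar n_1\cdots\bar n_k\leadsto\mathrm{inr}\,\bar n$ then $P(\bar n_1,\dots,\bar n_k,\bar n)$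 does not hold; (IR2) if $\mathrm{eval}_P\,\bar n_1\cdots\bar n_k\,\bar n\leadsto\mathrm{inl}\,\mathrm{unit}$ then $P(\bar n_1,\dots,\bar n_k,\bar n)$ holds; (IR3) if $\mathrm{query}_P\,s\,\bar n_1\cdots\bar n_k\leadsto\mathrm{inl}\,\mathrm{unit}$ and $\mathrm{eval}_P\,\bar n_1\cdots\bar n_k\,\bar n\leadsto\mathrm{inr}\,e$ then $e$ properly extends $s$. Monad: $TX=\mathrm{State}\to(X+\mathrm{Ex})$, $\mathrm{unit}_X=\lambda x{:}X.\lambda\_{:}\mathrm{State}.\mathrm{inl}\,x$, $\mathrm{star}$ and $\mathrm{merge}$ as usual for this state/exception monad (merge combining two exceptions with $\mathrm{merge}_{\mathrm{Ex}}$). Formulas built from atomic formulas (including $\bot$, never true) with $\wedge,\vee,\to,\forall,\exists$, $\neg A:=A\to\bot$. Types: $|P|=\mathrm{Unit}$, $|B\wedge C|=|B|\times|C|$, $|B\vee C|=|B|+|C|$, $|\exists xB|=\mathrm{Nat}\times|B|$, $|B\to C|=|B|\to\|C\|$, $|\forall xB|=\mathrm{Nat}\to\|B\|$, $\|A\|=T|A|$. For closed $s:\mathrm{State}$: $r\Vdash_T^sA$ iff $rs\leadsto\mathrm{inl}\,r'$ with $r'\Vdash^sA$, or $rs\leadsto\mathrm{inr}\,e$ with $e$ properly extending $s$; $r\Vdash^sP$ ($P$ atomic) iff $r\leadsto\mathrm{unit}$ and $P$ true; $r\Vdash^sB\wedge C$ iff $\pi_1r\Vdash^sB$ and $\pi_2r\Vdash^sC$;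 $r\Vdash^sB\vee C$ iff $r\leadsto\mathrm{inl}\,a$, $a\Vdash^sB$, or $r\leadsto\mathrm{inr}\,b$, $b\Vdash^sC$; $r\Vdash^sB\to C$ iff $rp\Vdash_T^sC$ for all $p\Vdash^sB$; $r\Vdash^s\forall xB$ iff $r\bar n\Vdash_T^sB[x:=\bar n]$ for all $n$; $r\Vdash^s\exists xB$ iff $\pi_2r\Vdash^sB[x:=\pi_1r]$. A decorated sequent $\alpha_1:A_1,\dots,\alpha_l:A_l\Vdash r:B$ (free arithmetic variables among $x_1,\dots,x_m$) is valid w.r.t. $\Vdash_T^s$ if for all $n_1,\dots,n_m$ and closed $p_i:|A_i|$ with $p_i\Vdash^sA_i[\vec x:=\vec{\bar n}]$, $r[\vec x:=\vec{\bar n},\vec\alpha:=\vec p]\Vdash_T^sB[\vec x:=\vec{\bar n}]$. -}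

module Defs where

open import Data.Nat using (ℕ; zero; suc)
open import Data.Fin using (Fin; zero; suc)
open import Data.Vec using (Vec; []; _∷_; _∷ʳ_; lookup; replicate)
open import Data.List using (List; []; _∷_)
open import Data.Product using (Σ; _×_; _,_)
open import Data.Sum using (_⊎_)
open import Data.Unit using (⊤)
open import Data.Empty using (⊥)
open import Relation.Binary.Construct.Closure.ReflexiveTransitive using (Star)

infixr 5 _⇒_
infixr 6 _⊕_
infixr 7 _⊗_

data Ty : Set where
  Unit Nat State Ex : Ty
  _⇒_ _⊗_ _⊕_ : Ty → Ty → Ty

Ctx : Set
Ctx = List Ty

Nats : ℕ → Ty → Ty
Nats zero    X = X
Nats (suc k) X = Nat ⇒ Nats k X

T : Ty → Ty
T X = State ⇒ (X ⊕ Ex)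

infix 4 _∋_
data _∋_ : Ctx → Ty → Set where
  here  : ∀ {Γ A} → (A ∷ Γ) ∋ A
  there : ∀ {Γ A B} → Γ ∋ A → (B ∷ Γ) ∋ A

-- A signature: predicate symbols of each arity, function symbols of each
-- arity (arithmetic terms), and any further constants of T' (bounded
-- course-of-value recursors, constants of type State, ...).

record Signature : Set₁ where
  field
    Pred  : ℕ → Set
    Fun   : ℕ → Set
    Extra : Ty → Set

module Syntax (sig : Signature) where
  open Signature sig

  data Const : Ty → Set where
    unit    : Const Unit
    pair    : ∀ {A B} → Const (A ⇒ B ⇒ A ⊗ B)
    π₁      : ∀ {A B} → Const (A ⊗ B ⇒ A)
    π₂      : ∀ {A B} → Const (A ⊗ B ⇒ B)
    inl     : ∀ {A B} → Const (A ⇒ A ⊕ B)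
    inr     : ∀ {A B} → Const (B ⇒ A ⊕ B)
    case    : ∀ {A B C} → Const (A ⊕ B ⇒ (A ⇒ C) ⇒ (B ⇒ C) ⇒ C)
    zeroC   : Const Nat
    S       : Const (Nat ⇒ Nat)
    mergeEx : Const (Ex ⇒ Ex ⇒ Ex)
    query   : ∀ {k} → Pred (suc k) → Const (State ⇒ Nats k (Unit ⊕ Nat))
    eval    : ∀ {k} → Pred (suc k) → Const (Nats k (Nat ⇒ Unit ⊕ Ex))
    fn      : ∀ {n} → Fun n → Const (Nats n Nat)
    extra   : ∀ {A} → Extra A → Const A

  data Tm (Γ : Ctx) : Ty → Set where
    var : ∀ {A} → Γ ∋ A → Tm Γ A
    lam : ∀ {A B} → Tm (A ∷ Γ) B → Tm Γ (A ⇒ B)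
    app : ∀ {A B} → Tm Γ (A ⇒ B) → Tm Γ A → Tm Γ B
    con : ∀ {A} → Const A → Tm Γ A

  Ren : Ctx → Ctx → Set
  Ren Γ Δ = ∀ {A} → Γ ∋ A → Δ ∋ A

  ext : ∀ {Γ Δ B} → Ren Γ Δ → Ren (B ∷ Γ) (B ∷ Δ)
  ext ρ here      = here
  ext ρ (there x) = there (ρ x)

  rename : ∀ {Γ Δ A} → Ren Γ Δ → Tm Γ A → Tm Δ A
  rename ρ (var x)   = var (ρ x)
  rename ρ (lam t)   = lam (rename (ext ρ) t)
  rename ρ (app t u) = app (rename ρ t) (rename ρ u)
  rename ρ (con c)   = con c

  wk : ∀ {Γ A B} → Tm Γ A → Tm (B ∷ Γ) A
  wk = rename there

  Sub : Ctx → Ctx → Set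
  Sub Γ Δ = ∀ {A} → Γ ∋ A → Tm Δ A

  exts : ∀ {Γ Δ B} → Sub Γ Δ → Sub (B ∷ Γ) (B ∷ Δ)
  exts σ here      = var here
  exts σ (there x) = wk (σ x)

  subst : ∀ {Γ Δ A} → Sub Γ Δ → Tm Γ A → Tm Δ A
  subst σ (var x)   = σ x
  subst σ (lam t)   = lam (subst (exts σ) t)
  subst σ (app t u) = app (subst σ t) (subst σ u)
  subst σ (con c)   = con c

  _[_] : ∀ {Γ A B} → Tm (B ∷ Γ) A → Tm Γ B → Tm Γ A
  _[_] {Γ} {A} {B} t u = subst σ t
    where
      σ : Sub (B ∷ Γ) Γ
      σ here      = u
      σ (there x) = var x

  num : ∀ {Γ} → ℕ → Tm Γ Nat
  num zero    = con zeroC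
  num (suc n) = app (con S) (num n)

  appN : ∀ {Γ k X} → Tm Γ (Nats k X) → Vec (Tm Γ Nat) k → Tm Γ X
  appN t []       = t
  appN t (u ∷ us) = appN (app t u) us

  data ATm (m : ℕ) : Set where
    avar  : Fin m → ATm m
    azero : ATm m
    asuc  : ATm m → ATm m
    afun  : ∀ {n} → Fun n → Vec (ATm m) n → ATm m

  mutual
    arename : ∀ {m m'} → (Fin m → Fin m') → ATm m → ATm m'
    arename f (avar i)    = avar (f i)
    arename f azero       = azero
    arename f (asuc t)    = asuc (arename f t)
    arename f (afun g ts) = afun g (arenameV f ts)

    arenameV : ∀ {m m' n} → (Fin m → Fin m') → Vec (ATm m) n → Vec (ATm m') n
    arenameV f []       = []
    arenameV f (t ∷ ts) = arename f t ∷ arenameV f ts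

  replicateNat : ℕ → Ctx
  replicateNat zero    = []
  replicateNat (suc m) = Nat ∷ replicateNat m

  natVar : ∀ {m} → Fin m → replicateNat m ∋ Nat
  natVar zero    = here
  natVar (suc i) = there (natVar i)

  mutual
    embed : ∀ {m} → ATm m → Tm (replicateNat m) Nat
    embed (avar i)    = var (natVar i)
    embed azero       = con zeroC
    embed (asuc t)    = app (con S) (embed t)
    embed (afun f ts) = appN (con (fn f)) (embedV ts)

    embedV : ∀ {m n} → Vec (ATm m) n → Vec (Tm (replicateNat m) Nat) n
    embedV []       = []
    embedV (t ∷ ts) = embed t ∷ embedV ts

  infixr 6 _∧'_
  infixr 5 _∨'_
  infixr 4 _⊃_

  data Fm (m : ℕ) : Set where
    ⊥'   : Fm m
    atom : ∀ {n} → Pred n → Vec (ATm m) n → Fm m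
    _∧'_ _∨'_ _⊃_ : Fm m → Fm m → Fm m
    ∀' ∃' : Fm (suc m) → Fm m

  ¬' : ∀ {m} → Fm m → Fm m
  ¬' A = A ⊃ ⊥'

  ∣_∣ : ∀ {m} → Fm m → Ty
  ∣ ⊥' ∣       = Unit
  ∣ atom P ts ∣ = Unit
  ∣ B ∧' C ∣    = ∣ B ∣ ⊗ ∣ C ∣
  ∣ B ∨' C ∣    = ∣ B ∣ ⊕ ∣ C ∣
  ∣ B ⊃ C ∣     = ∣ B ∣ ⇒ T ∣ C ∣
  ∣ ∀' B ∣      = Nat ⇒ T ∣ B ∣
  ∣ ∃' B ∣      = Nat ⊗ ∣ B ∣

  -- EM(P, t1..tk) = (∀y P(t,y)) ∨ (∃y ¬P(t,y));  y is the new variable 0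
  EM : ∀ {m k} → Pred (suc k) → Vec (ATm m) k → Fm m
  EM P ts = ∀' (atom P (arenameV suc ts ∷ʳ avar zero))
            ∨' ∃' (¬' (atom P (arenameV suc ts ∷ʳ avar zero)))

  -- unit_Unit = λx:Unit. λ_:State. inl x
  unitT : ∀ {Γ} → Tm Γ (Unit ⇒ T Unit)
  unitT = lam (lam (app (con inl) (var (there here))))

  mapV : ∀ {A B : Set} {n} → (A → B) → Vec A n → Vec B n
  mapV f []       = []
  mapV f (x ∷ xs) = f x ∷ mapV f xs

  em : ∀ {Γ k} → Pred (suc k) → Vec (Tm Γ Nat) k
     → Tm Γ (T ((Nat ⇒ T Unit) ⊕ (Nat ⊗ (Unit ⇒ T Unit))))
  em {Γ} P ts = lam (app (con inl) (app (app (app (con case) q) left) right))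
    where
      q : Tm (State ∷ Γ) (Unit ⊕ Nat)
      q = appN (app (con (query P)) (var here)) (mapV wk ts)
      -- λ_:Unit. inl (λy:Nat. λ_:State. eval_P t1..tk y)
      left : Tm (State ∷ Γ) (Unit ⇒ (Nat ⇒ T Unit) ⊕ (Nat ⊗ (Unit ⇒ T Unit)))
      left = lam (app (con inl) (lam (lam
               (app (appN (con (eval P)) (mapV (λ t → wk (wk (wk (wk t)))) ts))
                    (var (there here))))))
      -- λy:Nat. inr (pair y unit_Unit)
      right : Tm (State ∷ Γ) (Nat ⇒ (Nat ⇒ T Unit) ⊕ (Nat ⊗ (Unit ⇒ T Unit)))
      right = lam (app (con inr) (app (app (con pair) (var here)) unitT))

  -- contexts of decorated sequents: proof variables α_i : |A_i| followed
  -- by the arithmetic variables x_1..x_m (of type Nat)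

  seqCtx : ∀ {m} → List (Fm m) → Ctx
  seqCtx {m} []       = replicateNat m
  seqCtx {m} (A ∷ As) = ∣ A ∣ ∷ seqCtx As

  liftArith : ∀ {m} (As : List (Fm m)) → Ren (replicateNat m) (seqCtx As)
  liftArith []       x = x
  liftArith (A ∷ As) x = there (liftArith As x)

  embedIn : ∀ {m} (As : List (Fm m)) → ATm m → Tm (seqCtx As) Nat
  embedIn As t = rename (liftArith As) (embed t)

  data PEnv {m : ℕ} : List (Fm m) → Set where
    []  : PEnv []
    _∷_ : ∀ {A As} → Tm [] ∣ A ∣ → PEnv As → PEnv (A ∷ As)

  natSub : ∀ {m} → Vec ℕ m → Sub (replicateNat m) []
  natSub (n ∷ ρ) here      = num n
  natSub (n ∷ ρ) (there x) = natSub ρ x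

  closeSub : ∀ {m} {As : List (Fm m)} → Vec ℕ m → PEnv As → Sub (seqCtx As) []
  closeSub ρ []       x         = natSub ρ x
  closeSub ρ (p ∷ ps) here      = p
  closeSub ρ (p ∷ ps) (there x) = closeSub ρ ps x

-- Semantic data: extra reduction rules (δ-rules for the constants
-- query/eval/mergeEx/recursors/function symbols, left abstract), values of
-- function symbols, truth of predicate symbols, and "e properly extends s".

record Semantics (sig : Signature) : Set₁ where
  open Signature sig
  open Syntax sig
  field
    δ        : ∀ {Γ A} → Tm Γ A → Tm Γ A → Set
    funVal   : ∀ {n} → Fun n → Vec ℕ n → ℕ
    Holds    : ∀ {n} → Pred n → Vec ℕ n → Set
    Extends  : Tm [] Ex → Tm [] State → Set

module Realizability (sig : Signature) (sem : Semantics sig) where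
  open Signature sig public
  open Syntax sig public
  open Semantics sem public

  infix 3 _⟶_ _⇝_

  data _⟶_ {Γ} : ∀ {A} → Tm Γ A → Tm Γ A → Set where
    β     : ∀ {A B} {t : Tm (A ∷ Γ) B} {u} → app (lam t) u ⟶ t [ u ]
    π₁β   : ∀ {A B} {a : Tm Γ A} {b : Tm Γ B}
          → app (con π₁) (app (app (con pair) a) b) ⟶ a
    π₂β   : ∀ {A B} {a : Tm Γ A} {b : Tm Γ B}
          → app (con π₂) (app (app (con pair) a) b) ⟶ b
    caseˡ : ∀ {A B C} {a : Tm Γ A} {f : Tm Γ (A ⇒ C)} {g : Tm Γ (B ⇒ C)}
          → app (app (app (con case) (app (con inl) a)) f) g ⟶ app f a
    caseʳ : ∀ {A B C} {b : Tm Γ B} {f : Tm Γ (A ⇒ C)} {g : Tm Γ (B ⇒ C)}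
          → app (app (app (con case) (app (con inr) b)) f) g ⟶ app g b
    δstep : ∀ {A} {t u : Tm Γ A} → δ t u → t ⟶ u
    ξapp₁ : ∀ {A B} {t t' : Tm Γ (A ⇒ B)} {u} → t ⟶ t' → app t u ⟶ app t' u
    ξapp₂ : ∀ {A B} {t : Tm Γ (A ⇒ B)} {u u'} → u ⟶ u' → app t u ⟶ app t u'
    ξlam  : ∀ {A B} {t t' : Tm (A ∷ Γ) B} → t ⟶ t' → lam t ⟶ lam t'

  _⇝_ : ∀ {Γ A} → Tm Γ A → Tm Γ A → Set
  _⇝_ = Star _⟶_

  mutual
    value : ∀ {m} → Vec ℕ m → ATm m → ℕ
    value ρ (avar i)    = lookup ρ i
    value ρ azero       = zero
    value ρ (asuc t)    = suc (value ρ t)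
    value ρ (afun f ts) = funVal f (valueV ρ ts)

    valueV : ∀ {m n} → Vec ℕ m → Vec (ATm m) n → Vec ℕ n
    valueV ρ []       = []
    valueV ρ (t ∷ ts) = value ρ t ∷ valueV ρ ts

  -- Realizability  r ⊩^s A[x := ρ]  and  r ⊩_T^s A[x := ρ]
  mutual
    Real : ∀ {m} → Tm [] State → Vec ℕ m → (A : Fm m) → Tm [] ∣ A ∣ → Set
    Real s ρ ⊥'          r = (r ⇝ con unit) × ⊥
    Real s ρ (atom P ts) r = (r ⇝ con unit) × Holds P (valueV ρ ts)
    Real s ρ (B ∧' C)    r = Real s ρ B (app (con π₁) r) × Real s ρ C (app (con π₂) r)
    Real s ρ (B ∨' C)    r = (Σ (Tm [] ∣ B ∣) λ a → (r ⇝ app (con inl) a) × Real s ρ B a)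
                           ⊎ (Σ (Tm [] ∣ C ∣) λ b → (r ⇝ app (con inr) b) × Real s ρ C b)
    Real s ρ (B ⊃ C)     r = ∀ (p : Tm [] ∣ B ∣) → Real s ρ B p → RealT s ρ C (app r p)
    Real s ρ (∀' B)      r = ∀ (n : ℕ) → RealT s (n ∷ ρ) B (app r (num n))
    Real s ρ (∃' B)      r = Σ ℕ λ n → (app (con π₁) r ⇝ num n)
                                     × Real s (n ∷ ρ) B (app (con π₂) r)

    RealT : ∀ {m} → Tm [] State → Vec ℕ m → (A : Fm m) → Tm [] (T ∣ A ∣) → Set
    RealT s ρ A r = (Σ (Tm [] ∣ A ∣) λ r' → (app r s ⇝ app (con inl) r') × Real s ρ A r')
                  ⊎ (Σ (Tm [] Ex) λ e → (app r s ⇝ app (con inr) e) × Extends e s)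

  RealEnv : ∀ {m} {As : List (Fm m)} → Tm [] State → Vec ℕ m → PEnv As → Set
  RealEnv s ρ []                  = ⊤
  RealEnv s ρ (_∷_ {A = A} p ps)  = Real s ρ A p × RealEnv s ρ ps

  Valid : ∀ {m} → Tm [] State → (As : List (Fm m)) (B : Fm m)
        → Tm (seqCtx As) (T ∣ B ∣) → Set
  Valid {m} s As B r =
    ∀ (ρ : Vec ℕ m) (ps : PEnv As) → RealEnv s ρ ps → RealT s ρ B (subst (closeSub ρ ps) r)

  queryTm : ∀ {k} → Pred (suc k) → Tm [] State → Vec ℕ k → Tm [] (Unit ⊕ Nat)
  queryTm P s ns = appN (app (con (query P)) s) (mapV num ns)

  evalTm : ∀ {k} → Pred (suc k) → Vec ℕ k → ℕ → Tm [] (Unit ⊕ Ex)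
  evalTm P ns n = app (appN (con (eval P)) (mapV num ns)) (num n)

  record Assumptions : Set where
    field
      -- closed arithmetic terms reduce to the numerals of their values
      -- (the closed term t[x := n̄] is written  subst (natSub ρ) (embed t))
      arith   : ∀ {m} (ρ : Vec ℕ m) (t : ATm m)
              → subst (natSub ρ) (embed t) ⇝ num (value ρ t)
      EX      : ∀ (s : Tm [] State) (e₁ e₂ : Tm [] Ex) → Extends e₁ s → Extends e₂ s
              → Extends (app (app (con mergeEx) e₁) e₂) s
      IR1     : ∀ {k} (P : Pred (suc k)) (s : Tm [] State) (ns : Vec ℕ k) (n : ℕ)
              → queryTm P s ns ⇝ app (con inr) (num n)
              → Holds P (ns ∷ʳ n) → ⊥
      IR2     : ∀ {k} (P : Pred (suc k)) (ns : Vec ℕ k) (n : ℕ)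
              → evalTm P ns n ⇝ app (con inl) (con unit)
              → Holds P (ns ∷ʳ n)
      IR3     : ∀ {k} (P : Pred (suc k)) (s : Tm [] State) (ns : Vec ℕ k) (n : ℕ) (e : Tm [] Ex)
              → queryTm P s ns ⇝ app (con inl) (con unit)
              → evalTm P ns n ⇝ app (con inr) e
              → Extends e s
      -- normal forms of query_P and eval_P on numerals (normalization /
      -- canonical forms of T' for these closed terms of sum type)
      queryNF : ∀ {k} (P : Pred (suc k)) (s : Tm [] State) (ns : Vec ℕ k)
              → (queryTm P s ns ⇝ app (con inl) (con unit))
              ⊎ (Σ ℕ λ n → queryTm P s ns ⇝ app (con inr) (num n))
      evalNF  : ∀ {k} (P : Pred (suc k)) (ns : Vec ℕ k) (n : ℕ)
              → (evalTm P ns n ⇝ app (con inl) (con unit))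
              ⊎ (Σ (Tm [] Ex) λ e → evalTm P ns n ⇝ app (con inr) e)

-- After the closing substitution and the state s, em first asks query_P s t̄.  If the answer
-- is inr n, then (IR1) says ¬P(t̄, n), so n witnesses the right disjunct.  If the answer is
-- inl unit, the left disjunct is realized by y ↦ eval_P t̄ y: at each y this either
-- succeeds, and then P(t̄, y) holds by (IR2), or raises an exception e, which properly
-- extends s by (IR3).
module Submission where

open import Defs
open import Data.Nat using (ℕ; suc)
open import Data.Fin using (Fin; zero; suc)
open import Data.Vec using (Vec; []; _∷_; _∷ʳ_; lookup)
open import Data.Vec.Relation.Binary.Pointwise.Inductive using (Pointwise; []; _∷_)
open import Data.List using (List; []; _∷_; _++_)
open import Data.Product using (_,_)
open import Data.Sum using (inj₁; inj₂)
open import Data.Empty using (⊥-elim)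
open import Function using (_∘_)
open import Relation.Binary.PropositionalEquality
  using (_≡_; refl; sym; trans; cong; cong₂) renaming (subst to transport)
open import Relation.Binary.Construct.Closure.ReflexiveTransitive using (ε; _◅_; _◅◅_; gmap)

module Substitution (sig : Signature) where
  open Syntax sig

  ext-cong : ∀ {Γ Δ B} {f g : Ren Γ Δ} → (∀ {C} (x : Γ ∋ C) → f x ≡ g x)
           → ∀ {C} (x : (B ∷ Γ) ∋ C) → ext f x ≡ ext g x
  ext-cong f≗g here      = refl
  ext-cong f≗g (there x) = cong there (f≗g x)

  rename-cong : ∀ {Γ Δ A} {f g : Ren Γ Δ} → (∀ {C} (x : Γ ∋ C) → f x ≡ g x)
              → (t : Tm Γ A) → rename f t ≡ rename g t
  rename-cong f≗g (var x)   = cong var (f≗g x)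
  rename-cong f≗g (lam t)   = cong lam (rename-cong (ext-cong f≗g) t)
  rename-cong f≗g (app t u) = cong₂ app (rename-cong f≗g t) (rename-cong f≗g u)
  rename-cong f≗g (con c)   = refl

  rename-rename : ∀ {Γ Δ Θ A} (f : Ren Δ Θ) (g : Ren Γ Δ) (t : Tm Γ A)
                → rename f (rename g t) ≡ rename (λ x → f (g x)) t
  rename-rename f g (var x)   = refl
  rename-rename f g (lam t)   =
    cong lam (trans (rename-rename (ext f) (ext g) t) (rename-cong ext-∘ t))
    where
      ext-∘ : ∀ {C} (x : _ ∋ C) → ext f (ext g x) ≡ ext (λ y → f (g y)) x
      ext-∘ here      = refl
      ext-∘ (there x) = refl
  rename-rename f g (app t u) = cong₂ app (rename-rename f g t) (rename-rename f g u)
  rename-rename f g (con c)   = refl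

  exts-cong : ∀ {Γ Δ B} {σ τ : Sub Γ Δ} → (∀ {C} (x : Γ ∋ C) → σ x ≡ τ x)
            → ∀ {C} (x : (B ∷ Γ) ∋ C) → exts σ x ≡ exts τ x
  exts-cong σ≗τ here      = refl
  exts-cong σ≗τ (there x) = cong wk (σ≗τ x)

  subst-cong : ∀ {Γ Δ A} {σ τ : Sub Γ Δ} → (∀ {C} (x : Γ ∋ C) → σ x ≡ τ x)
             → (t : Tm Γ A) → subst σ t ≡ subst τ t
  subst-cong σ≗τ (var x)   = σ≗τ x
  subst-cong σ≗τ (lam t)   = cong lam (subst-cong (exts-cong σ≗τ) t)
  subst-cong σ≗τ (app t u) = cong₂ app (subst-cong σ≗τ t) (subst-cong σ≗τ u)
  subst-cong σ≗τ (con c)   = refl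

  subst-rename : ∀ {Γ Δ Θ A} (σ : Sub Δ Θ) (f : Ren Γ Δ) (t : Tm Γ A)
               → subst σ (rename f t) ≡ subst (λ x → σ (f x)) t
  subst-rename σ f (var x)   = refl
  subst-rename σ f (lam t)   =
    cong lam (trans (subst-rename (exts σ) (ext f) t) (subst-cong exts-∘-ext t))
    where
      exts-∘-ext : ∀ {C} (x : _ ∋ C) → exts σ (ext f x) ≡ exts (λ y → σ (f y)) x
      exts-∘-ext here      = refl
      exts-∘-ext (there x) = refl
  subst-rename σ f (app t u) = cong₂ app (subst-rename σ f t) (subst-rename σ f u)
  subst-rename σ f (con c)   = refl

  rename-subst : ∀ {Γ Δ Θ A} (f : Ren Δ Θ) (σ : Sub Γ Δ) (t : Tm Γ A)
               → rename f (subst σ t) ≡ subst (λ x → rename f (σ x)) t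
  rename-subst f σ (var x)   = refl
  rename-subst f σ (lam t)   =
    cong lam (trans (rename-subst (ext f) (exts σ) t) (subst-cong ext-∘-exts t))
    where
      ext-∘-exts : ∀ {C} (x : _ ∋ C) → rename (ext f) (exts σ x) ≡ exts (λ y → rename f (σ y)) x
      ext-∘-exts here      = refl
      ext-∘-exts (there x) = trans (rename-rename (ext f) there (σ x))
                                   (sym (rename-rename there f (σ x)))
  rename-subst f σ (app t u) = cong₂ app (rename-subst f σ t) (rename-subst f σ u)
  rename-subst f σ (con c)   = refl

  subst-id : ∀ {Γ A} (t : Tm Γ A) → subst var t ≡ t
  subst-id (var x)   = refl
  subst-id (lam t)   = cong lam (trans (subst-cong exts-var t) (subst-id t))
    where
      exts-var : ∀ {C} (x : _ ∋ C) → exts var x ≡ var x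
      exts-var here      = refl
      exts-var (there x) = refl
  subst-id (app t u) = cong₂ app (subst-id t) (subst-id u)
  subst-id (con c)   = refl

  subst-exts-wk : ∀ {Γ Δ A B} (σ : Sub Γ Δ) (u : Tm Γ A)
                → subst (exts {B = B} σ) (wk u) ≡ wk (subst σ u)
  subst-exts-wk σ u = trans (subst-rename (exts σ) there u) (sym (rename-subst there σ u))

  subst-wk-closed : ∀ {A B} (τ : Sub (B ∷ []) []) (c : Tm [] A) → subst τ (wk c) ≡ c
  subst-wk-closed τ c =
    trans (subst-rename τ there c) (trans (subst-cong (λ ()) c) (subst-id c))

  wk⋆ : ∀ {Γ A} (Θ : Ctx) → Tm Γ A → Tm (Θ ++ Γ) A
  wk⋆ []      u = u
  wk⋆ (B ∷ Θ) u = wk (wk⋆ Θ u)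

  exts⋆ : ∀ {Γ Δ} (Θ : Ctx) → Sub Γ Δ → Sub (Θ ++ Γ) (Θ ++ Δ)
  exts⋆ []      σ = σ
  exts⋆ (B ∷ Θ) σ = exts (exts⋆ Θ σ)

  subst-exts⋆-wk⋆ : ∀ {Γ Δ A} (Θ : Ctx) (σ : Sub Γ Δ) (u : Tm Γ A)
                  → subst (exts⋆ Θ σ) (wk⋆ Θ u) ≡ wk⋆ Θ (subst σ u)
  subst-exts⋆-wk⋆ []      σ u = refl
  subst-exts⋆-wk⋆ (B ∷ Θ) σ u =
    trans (subst-exts-wk (exts⋆ Θ σ) (wk⋆ Θ u)) (cong wk (subst-exts⋆-wk⋆ Θ σ u))

  subst-exts⋆-wk⋆-closed : ∀ {A B} (Θ : Ctx) (τ : Sub (B ∷ []) []) (c : Tm [] A)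
                         → subst (exts⋆ Θ τ) (wk⋆ Θ (wk c)) ≡ wk⋆ Θ c
  subst-exts⋆-wk⋆-closed Θ τ c =
    trans (subst-exts⋆-wk⋆ Θ τ (wk c)) (cong (wk⋆ Θ) (subst-wk-closed τ c))

  -- F is meant to be a composite of substitutions, which commutes with app by definition.
  appN-homomorphic : ∀ {Γ Δ k X} {Y : Set} (F : ∀ {A} → Tm Γ A → Tm Δ A)
                   → (∀ {A B} (a : Tm Γ (A ⇒ B)) (b : Tm Γ A) → F (app a b) ≡ app (F a) (F b))
                   → (f : Tm Γ (Nats k X)) (g : Y → Tm Γ Nat) (ys : Vec Y k)
                   → F (appN f (mapV g ys)) ≡ appN (F f) (mapV (λ y → F (g y)) ys)
  appN-homomorphic F F-app f g []       = refl
  appN-homomorphic F F-app f g (y ∷ ys) =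
    trans (appN-homomorphic F F-app (app f (g y)) g ys)
          (cong (λ h → appN h (mapV (λ y → F (g y)) ys)) (F-app f (g y)))

module EMRealizability (sig : Signature) (sem : Semantics sig) where
  open Realizability sig sem
  open Substitution sig

  ≡⇒⇝ : ∀ {Γ A} {a b : Tm Γ A} → a ≡ b → a ⇝ b
  ≡⇒⇝ refl = ε

  app⇝ : ∀ {Γ A B} {f f' : Tm Γ (A ⇒ B)} {u u'} → f ⇝ f' → u ⇝ u' → app f u ⇝ app f' u'
  app⇝ {f' = f'} {u = u} f⇝f' u⇝u' = gmap (λ h → app h u) ξapp₁ f⇝f' ◅◅ gmap (app f') ξapp₂ u⇝u'

  case⇝ : ∀ {Γ A B C} {q q' : Tm Γ (A ⊕ B)} {f : Tm Γ (A ⇒ C)} {g : Tm Γ (B ⇒ C)}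
        → q ⇝ q' → app (app (app (con case) q) f) g ⇝ app (app (app (con case) q') f) g
  case⇝ {f = f} {g} = gmap (λ q → app (app (app (con case) q) f) g) (ξapp₁ ∘ ξapp₁ ∘ ξapp₂)

  Numerals : ∀ {k} → Vec (Tm [] Nat) k → Vec ℕ k → Set
  Numerals = Pointwise (λ u n → u ⇝ num n)

  appN⇝ : ∀ {k X} {f f' : Tm [] (Nats k X)} {us : Vec (Tm [] Nat) k} {ns : Vec ℕ k}
        → f ⇝ f' → Numerals us ns → appN f us ⇝ appN f' (mapV num ns)
  appN⇝ f⇝f' []           = f⇝f'
  appN⇝ f⇝f' (u⇝n ∷ us⇝ns) = appN⇝ (app⇝ f⇝f' u⇝n) us⇝ns

  mutual
    value-arename : ∀ {m m'} (f : Fin m → Fin m') (ρ' : Vec ℕ m') (ρ : Vec ℕ m)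
                  → (∀ i → lookup ρ' (f i) ≡ lookup ρ i)
                  → (t : ATm m) → value ρ' (arename f t) ≡ value ρ t
    value-arename f ρ' ρ f-lookup (avar i)    = f-lookup i
    value-arename f ρ' ρ f-lookup azero       = refl
    value-arename f ρ' ρ f-lookup (asuc t)    = cong suc (value-arename f ρ' ρ f-lookup t)
    value-arename f ρ' ρ f-lookup (afun g ts) = cong (funVal g) (valueV-arenameV f ρ' ρ f-lookup ts)

    valueV-arenameV : ∀ {m m' n} (f : Fin m → Fin m') (ρ' : Vec ℕ m') (ρ : Vec ℕ m)
                    → (∀ i → lookup ρ' (f i) ≡ lookup ρ i)
                    → (ts : Vec (ATm m) n) → valueV ρ' (arenameV f ts) ≡ valueV ρ ts
    valueV-arenameV f ρ' ρ f-lookup []       = refl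
    valueV-arenameV f ρ' ρ f-lookup (t ∷ ts) =
      cong₂ _∷_ (value-arename f ρ' ρ f-lookup t) (valueV-arenameV f ρ' ρ f-lookup ts)

  valueV-∷ʳ : ∀ {m n} (ρ : Vec ℕ m) (ts : Vec (ATm m) n) (t : ATm m)
            → valueV ρ (ts ∷ʳ t) ≡ valueV ρ ts ∷ʳ value ρ t
  valueV-∷ʳ ρ []       t = refl
  valueV-∷ʳ ρ (u ∷ us) t = cong (value ρ u ∷_) (valueV-∷ʳ ρ us t)

  valueV-EM-atom : ∀ {m k} (ρ : Vec ℕ m) (ts : Vec (ATm m) k) (n : ℕ)
                 → valueV (n ∷ ρ) (arenameV suc ts ∷ʳ avar zero) ≡ valueV ρ ts ∷ʳ n
  valueV-EM-atom ρ ts n = trans (valueV-∷ʳ (n ∷ ρ) (arenameV suc ts) (avar zero))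
                                (cong (_∷ʳ n) (valueV-arenameV suc (n ∷ ρ) ρ (λ _ → refl) ts))

  closeSub-liftArith : ∀ {m} (As : List (Fm m)) (ρ : Vec ℕ m) (ps : PEnv As)
                     → ∀ {C} (x : replicateNat m ∋ C) → closeSub ρ ps (liftArith As x) ≡ natSub ρ x
  closeSub-liftArith []       ρ []       x = refl
  closeSub-liftArith (A ∷ As) ρ (p ∷ ps) x = closeSub-liftArith As ρ ps x

  module _ (assumptions : Assumptions) where
    open Assumptions assumptions

    module _ {m} (As : List (Fm m)) (ρ : Vec ℕ m) (ps : PEnv As) where
      private
        σ : Sub (seqCtx As) []
        σ = closeSub ρ ps

      closed-embedIn⇝ : (t : ATm m) → subst σ (embedIn As t) ⇝ num (value ρ t)
      closed-embedIn⇝ t =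
        ≡⇒⇝ (trans (subst-rename σ (liftArith As) (embed t))
                   (subst-cong (closeSub-liftArith As ρ ps) (embed t)))
        ◅◅ arith ρ t

      closed-args⇝ : ∀ {k} (g : Tm (seqCtx As) Nat → Tm [] Nat) → (∀ u → g u ≡ subst σ u)
                   → (ts : Vec (ATm m) k) → Numerals (mapV g (mapV (embedIn As) ts)) (valueV ρ ts)
      closed-args⇝ g g≗σ []       = []
      closed-args⇝ g g≗σ (t ∷ ts) =
        (≡⇒⇝ (g≗σ (embedIn As t)) ◅◅ closed-embedIn⇝ t) ∷ closed-args⇝ g g≗σ ts

      module _ {k} (P : Pred (suc k)) (ts : Vec (ATm m) k) where
        private
          ts' : Vec (Tm (seqCtx As) Nat) k
          ts' = mapV (embedIn As) ts

        query⇝ : (τ : Sub (State ∷ []) [])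
               → subst τ (subst (exts σ) (appN (app (con (query P)) (var here)) (mapV wk ts')))
                 ⇝ queryTm P (τ here) (valueV ρ ts)
        query⇝ τ =
          ≡⇒⇝ (appN-homomorphic (λ t → subst τ (subst (exts σ) t)) (λ _ _ → refl) _ wk ts')
          ◅◅ appN⇝ ε (closed-args⇝ _ closes ts)
          where
            closes : ∀ u → subst τ (subst (exts σ) (wk u)) ≡ subst σ u
            closes u = trans (cong (subst τ) (subst-exts-wk σ u)) (subst-wk-closed τ (subst σ u))

        -- After the closing σ, the body of the ∀-realizer undergoes the β-substitutions of
        -- s, unit, the number y and the state at which y is tested.
        module _ (τ₃ : Sub (State ∷ []) []) (τ₂ : Sub (Unit ∷ []) [])
                 (τ₁ : Sub (Nat ∷ []) []) (τ₀ : Sub (State ∷ []) []) where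
          private
            Θ₁ Θ₂ Θ₃ Θ₄ : Ctx
            Θ₁ = State ∷ []
            Θ₂ = State ∷ Nat ∷ []
            Θ₃ = State ∷ Nat ∷ Unit ∷ []
            Θ₄ = State ∷ Nat ∷ Unit ∷ State ∷ []

            close : ∀ {A} → Tm (Θ₄ ++ seqCtx As) A → Tm [] A
            close t = subst τ₀ (subst (exts⋆ Θ₁ τ₁) (subst (exts⋆ Θ₂ τ₂)
                        (subst (exts⋆ Θ₃ τ₃) (subst (exts⋆ Θ₄ σ) t))))

            close-wk⋆ : ∀ (u : Tm (seqCtx As) Nat) → close (wk⋆ Θ₄ u) ≡ subst σ u
            close-wk⋆ u =
              let c = subst σ u in
              trans (cong (λ t → subst τ₀ (subst (exts⋆ Θ₁ τ₁) (subst (exts⋆ Θ₂ τ₂)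
                                   (subst (exts⋆ Θ₃ τ₃) t))))
                          (subst-exts⋆-wk⋆ Θ₄ σ u))
              (trans (cong (λ t → subst τ₀ (subst (exts⋆ Θ₁ τ₁) (subst (exts⋆ Θ₂ τ₂) t)))
                           (subst-exts⋆-wk⋆-closed Θ₃ τ₃ c))
              (trans (cong (λ t → subst τ₀ (subst (exts⋆ Θ₁ τ₁) t))
                           (subst-exts⋆-wk⋆-closed Θ₂ τ₂ c))
              (trans (cong (subst τ₀) (subst-exts⋆-wk⋆-closed Θ₁ τ₁ c))
                     (subst-wk-closed τ₀ c))))

          eval⇝ : close (app (appN (con (eval P)) (mapV (wk⋆ {A = Nat} Θ₄) ts')) (var (there here)))
                  ⇝ app (appN (con (eval P)) (mapV num (valueV ρ ts))) (τ₁ here)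
          eval⇝ =
            app⇝ (≡⇒⇝ (appN-homomorphic close (λ _ _ → refl) _ (wk⋆ {A = Nat} Θ₄) ts')
                  ◅◅ appN⇝ ε (closed-args⇝ _ close-wk⋆ ts))
                 (≡⇒⇝ (subst-wk-closed τ₀ (τ₁ here)))

        em-realizes-EM : (s : Tm [] State) → RealT s ρ (EM P ts) (subst σ (em P ts'))
        em-realizes-EM s = inj₁ (_ , β ◅ ε , realizes-EM)
          where
            ns : Vec ℕ k
            ns = valueV ρ ts

            P[t̄,y] : Fm (suc m)
            P[t̄,y] = atom P (arenameV suc ts ∷ʳ avar zero)

            realizes-EM : Real s ρ (EM P ts) _
            realizes-EM with queryNF P s ns
            ... | inj₁ q⇝inl = inj₁ (_ , case⇝ (query⇝ _ ◅◅ q⇝inl) ◅◅ caseˡ ◅ β ◅ ε , realizes-∀)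
              where
                realizes-∀ : Real s ρ (∀' P[t̄,y]) _
                realizes-∀ n with evalNF P ns n
                ... | inj₁ e⇝inl =
                  inj₁ (_ , (ξapp₁ β ◅ β ◅ ε) ◅◅ eval⇝ _ _ _ _ ◅◅ e⇝inl
                       , ε , transport (Holds P) (sym (valueV-EM-atom ρ ts n)) (IR2 P ns n e⇝inl))
                ... | inj₂ (e , e⇝inr) =
                  inj₂ (e , (ξapp₁ β ◅ β ◅ ε) ◅◅ eval⇝ _ _ _ _ ◅◅ e⇝inr , IR3 P s ns n e q⇝inl e⇝inr)
            ... | inj₂ (n , q⇝inr) =
              inj₂ (_ , case⇝ (query⇝ _ ◅◅ q⇝inr) ◅◅ caseʳ ◅ β ◅ ε , n , π₁β ◅ ε , refutes)
              where
                refutes : Real s (n ∷ ρ) (¬' P[t̄,y]) _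
                refutes _ (_ , holds) =
                  ⊥-elim (IR1 P s ns n q⇝inr (transport (Holds P) (valueV-EM-atom ρ ts n) holds))

mainTheorem3 : (sig : Signature) (sem : Semantics sig)
    → let open Realizability sig sem in
    Assumptions
    → ∀ {m k : ℕ} (P : Pred (suc k)) (ts : Vec (ATm m) k) (As : List (Fm m))
    → (s : Tm [] State)
    → Valid s As (EM P ts) (em P (mapV (embedIn As) ts))
mainTheorem3 sig sem assumptions P ts As s ρ ps _ =
  EMRealizability.em-realizes-EM sig sem assumptions As ρ ps P ts s
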